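{- Let $q$ and $e$ be coprime positive integers, and let $n := \mathrm{ord}_e(q)$ be the multiplicative order of $q$ modulo $e$ (the least positive integer $s$ with $q^s \equiv 1 \pmod e$). Then $$m(q,e) \le \left\lceil \frac{e}{n} \right\rceil.$$
   Context: For coprime positive integers $q,e$, $m(q,e)$ denotes the least positive integer $t$ such that there exist nonnegative integers $a_1,\ldots,a_t$ (repetitions allowed) with $q^{a_1}+\cdots+q^{a_t} \equiv 0 \pmod e$; equivalently, the least $t$ such that a sum of $t$ elements of the cyclic subgroup $\langle q+e\mathbb{Z}\rangle$ of $(\mathbb{Z}/e\mathbb{Z})^\times$ vanishes in $\mathbb{Z}/e\mathbb{Z}$. -}

module Defs where

open import Data.Nat using (ℕ; zero; suc; _+_; _*_; _∸_; _^_; _≤_; _<_; NonZero)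
open import Data.Nat.DivMod using (_/_; _%_)
open import Data.Nat.Divisibility using (_∣_)
open import Data.List using (List; length; map)
open import Data.Nat.ListAction using (sum)
open import Data.Product using (Σ; _×_; ∃-syntax)
open import Relation.Nullary using (¬_)
open import Relation.Binary.PropositionalEquality using (_≡_)

ModEq : ℕ → ℕ → (e : ℕ) → .{{NonZero e}} → Set
ModEq a b e = a % e ≡ b % e

IsOrder : (q e n : ℕ) → .{{NonZero e}} → Set
IsOrder q e n = (0 < n) × ModEq (q ^ n) 1 e
              × (∀ s → 0 < s → s < n → ¬ ModEq (q ^ s) 1 e)

ZeroSumOfPowers : (q e t : ℕ) → Set
ZeroSumOfPowers q e t =
  ∃[ as ] ((length as ≡ t) × (e ∣ sum (map (q ^_) as)))

-- t = m(q,e): the least positive t admitting such a vanishing sum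
IsM : (q e t : ℕ) → Set
IsM q e t = (0 < t) × ZeroSumOfPowers q e t
          × (∀ t′ → 0 < t′ → t′ < t → ¬ ZeroSumOfPowers q e t′)

⌈_/_⌉ : (a b : ℕ) → .{{NonZero b}} → ℕ
⌈ a / b ⌉ = (a + b ∸ 1) / b

-- The residues of q⁰, …, qⁿ⁻¹ modulo e form a set H of n distinct units of ℤ/e.
-- Let S_j be the set of residues of sums of between 1 and j + 1 powers of q, so
-- that S_{j+1} = S_j + (H ∪ {0}). Chowla's theorem (0 ∈ B and B ∖ {0} consists of
-- units ⇒ |A + B| ≥ min(e, |A| + |B| - 1)), proved by Dyson's e-transform, gives
-- S_j = ℤ/e or |S_j| ≥ (j + 1) n. For j + 1 = ⌈e/n⌉ this puts 0 in S_j, i.e.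
-- some sum of at most ⌈e/n⌉ powers of q is divisible by e.

module Submission where

open import Defs
open import Data.Bool using (Bool; true; false; _∨_; _∧_; not; if_then_else_; T)
open import Data.Bool.Properties using (∨-zeroʳ; ∧-comm; ∧-conicalˡ; ∧-conicalʳ)
open import Data.Empty using (⊥-elim)
open import Data.List using (List; []; _∷_; length; map)
open import Data.Nat
open import Data.Nat.Coprimality using (Coprime)
open import Data.Nat.DivMod
open import Data.Nat.Divisibility using (_∣_; 1∣_; m%n≡0⇒n∣m)
open import Data.Nat.ListAction using (sum)
open import Data.Nat.Properties
open import Data.Nat.Solver using (module +-*-Solver)
open import Data.Product using (_×_; _,_; proj₁; proj₂; ∃-syntax)
open import Data.Sum using (_⊎_; inj₁; inj₂; map₂)
open import Data.Unit using (tt)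
open import Relation.Binary.PropositionalEquality
open import Relation.Nullary using (¬_)
open import Function using (_∘_)

open +-*-Solver using (solve; _:+_; _:=_)

indicator : Bool → ℕ
indicator b = if b then 1 else 0

count : ℕ → (ℕ → Bool) → ℕ
count zero    P = 0
count (suc k) P = count k P + indicator (P k)

infix 4 _⊆⟨_⟩_

_⊆⟨_⟩_ : (ℕ → Bool) → ℕ → (ℕ → Bool) → Set
P ⊆⟨ k ⟩ Q = ∀ x → x < k → P x ≡ true → Q x ≡ true

⊆-pred : ∀ {P Q k} → P ⊆⟨ suc k ⟩ Q → P ⊆⟨ k ⟩ Q
⊆-pred P⊆Q x x<k = P⊆Q x (m<n⇒m<1+n x<k)

count-cong : ∀ k {P Q : ℕ → Bool} → (∀ x → x < k → P x ≡ Q x) → count k P ≡ count k Q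
count-cong zero    P≡Q = refl
count-cong (suc k) P≡Q =
  cong₂ _+_ (count-cong k (λ x x<k → P≡Q x (m<n⇒m<1+n x<k))) (cong indicator (P≡Q k ≤-refl))

indicator-mono : ∀ a b → (a ≡ true → b ≡ true) → indicator a ≤ indicator b
indicator-mono false b a⇒b = z≤n
indicator-mono true  b a⇒b rewrite a⇒b refl = ≤-refl

count-mono : ∀ k {P Q} → P ⊆⟨ k ⟩ Q → count k P ≤ count k Q
count-mono zero    P⊆Q = z≤n
count-mono (suc k) {P} {Q} P⊆Q =
  +-mono-≤ (count-mono k (⊆-pred P⊆Q)) (indicator-mono (P k) (Q k) (P⊆Q k ≤-refl))

count-mono-< : ∀ k {P Q} → P ⊆⟨ k ⟩ Q → ∀ {x} → x < k → P x ≡ false → Q x ≡ true →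
               count k P < count k Q
count-mono-< (suc k) {P} {Q} P⊆Q {x} x<1+k Px Qx with m≤n⇒m<n∨m≡n (s≤s⁻¹ x<1+k)
... | inj₁ x<k = +-mono-<-≤ (count-mono-< k (⊆-pred P⊆Q) x<k Px Qx)
                           (indicator-mono (P k) (Q k) (P⊆Q k ≤-refl))
... | inj₂ refl rewrite Px | Qx = +-mono-≤-< (count-mono x (⊆-pred P⊆Q)) z<s

indicator-∨-∧ : ∀ a b → indicator (a ∨ b) + indicator (a ∧ b) ≡ indicator a + indicator b
indicator-∨-∧ false false = refl
indicator-∨-∧ false true  = refl
indicator-∨-∧ true  false = refl
indicator-∨-∧ true  true  = refl

count-∨-∧ : ∀ k P Q → count k (λ x → P x ∨ Q x) + count k (λ x → P x ∧ Q x) ≡ count k P + count k Q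
count-∨-∧ zero    P Q = refl
count-∨-∧ (suc k) P Q = begin
  (U + u) + (I + i)  ≡⟨ solve 4 (λ U u I i → (U :+ u) :+ (I :+ i) := (U :+ I) :+ (u :+ i)) refl U u I i ⟩
  (U + I) + (u + i)  ≡⟨ cong₂ _+_ (count-∨-∧ k P Q) (indicator-∨-∧ (P k) (Q k)) ⟩
  (A + B) + (a + b)  ≡⟨ solve 4 (λ A B a b → (A :+ B) :+ (a :+ b) := (A :+ a) :+ (B :+ b)) refl A B a b ⟩
  (A + a) + (B + b)  ∎
  where
  open ≡-Reasoning
  U = count k (λ x → P x ∨ Q x)
  I = count k (λ x → P x ∧ Q x)
  A = count k P
  B = count k Q
  u = indicator (P k ∨ Q k)
  i = indicator (P k ∧ Q k)
  a = indicator (P k)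
  b = indicator (Q k)

count-true : ∀ k → count k (λ _ → true) ≡ k
count-true zero    = refl
count-true (suc k) = trans (cong (_+ 1) (count-true k)) (+-comm k 1)

count≥k⇒all : ∀ k {P} → k ≤ count k P → ∀ x → x < k → P x ≡ true
count≥k⇒all k {P} k≤∣P∣ x x<k with P x in Px
... | true  = refl
... | false = ⊥-elim (<-irrefl refl (<-≤-trans
                (count-mono-< k (λ _ _ _ → refl) x<k Px refl)
                (≤-trans (≤-reflexive (count-true k)) k≤∣P∣)))

indicator-false : ∀ b → ¬ b ≡ true → indicator b ≡ 0
indicator-false false _   = refl
indicator-false true  b≢t = ⊥-elim (b≢t refl)

count-≤1 : ∀ k {P} → (∀ x → x < k → P x ≡ true → x ≡ 0) → count k P ≤ 1
count-≤1 zero          only0 = z≤n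
count-≤1 (suc zero)    {P} only0 = indicator-mono (P 0) true (λ _ → refl)
count-≤1 (suc (suc k)) {P} only0 = begin
  count (suc k) P + indicator (P (suc k)) ≡⟨ cong (count (suc k) P +_) P[1+k]≡0 ⟩
  count (suc k) P + 0                     ≤⟨ +-monoˡ-≤ 0 (count-≤1 (suc k) (λ x x<k → only0 x (m<n⇒m<1+n x<k))) ⟩
  1                                       ∎
  where
  open ≤-Reasoning
  P[1+k]≡0 : indicator (P (suc k)) ≡ 0
  P[1+k]≡0 = indicator-false (P (suc k)) (1+n≢0 ∘ only0 (suc k) ≤-refl)

count-unfoldˡ : ∀ k P → count (suc k) P ≡ indicator (P 0) + count k (P ∘ suc)
count-unfoldˡ zero    P = +-comm 0 (indicator (P 0))
count-unfoldˡ (suc k) P = begin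
  count (suc k) P + indicator (P (suc k))                     ≡⟨ cong (_+ indicator (P (suc k))) (count-unfoldˡ k P) ⟩
  indicator (P 0) + count k (P ∘ suc) + indicator (P (suc k)) ≡⟨ +-assoc (indicator (P 0)) _ _ ⟩
  indicator (P 0) + count (suc k) (P ∘ suc)                   ∎
  where open ≡-Reasoning

count-rotate : ∀ k P → P k ≡ P 0 → count k (P ∘ suc) ≡ count k P
count-rotate zero    P _      = refl
count-rotate (suc k) P Pk≡P0 = begin
  count k (P ∘ suc) + indicator (P (suc k)) ≡⟨ cong (λ b → count k (P ∘ suc) + indicator b) Pk≡P0 ⟩
  count k (P ∘ suc) + indicator (P 0)       ≡⟨ +-comm _ (indicator (P 0)) ⟩
  indicator (P 0) + count k (P ∘ suc)       ≡⟨ count-unfoldˡ k P ⟨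
  count (suc k) P                           ∎
  where open ≡-Reasoning

any< : ℕ → (ℕ → Bool) → Bool
any< zero    P = false
any< (suc k) P = P k ∨ any< k P

any<-witness : ∀ k P → any< k P ≡ true → ∃[ x ] x < k × P x ≡ true
any<-witness (suc k) P any with P k in Pk
... | true  = k , ≤-refl , Pk
... | false with any<-witness k P any
...   | x , x<k , Px = x , m<n⇒m<1+n x<k , Px

any<-intro : ∀ k P {x} → x < k → P x ≡ true → any< k P ≡ true
any<-intro (suc k) P {x} x<1+k Px with P k in Pk | m≤n⇒m<n∨m≡n (s≤s⁻¹ x<1+k)
... | true  | _          = refl
... | false | inj₁ x<k   = any<-intro k P x<k Px
... | false | inj₂ refl  with () <- trans (sym Px) Pk

search : ∀ k P → (∃[ x ] x < k × P x ≡ true) ⊎ (∀ x → x < k → P x ≡ false)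
search k P with any< k P in any
... | true  = inj₁ (any<-witness k P any)
... | false = inj₂ refuted
  where
  refuted : ∀ x → x < k → P x ≡ false
  refuted x x<k with P x in Px
  ... | false = refl
  ... | true  with () <- trans (sym (any<-intro k P x<k Px)) any

≡ᵇ-sound : ∀ m n → (m ≡ᵇ n) ≡ true → m ≡ n
≡ᵇ-sound m n m≡ᵇn = ≡ᵇ⇒≡ m n (subst T (sym m≡ᵇn) tt)

≡ᵇ-refl : ∀ m → (m ≡ᵇ m) ≡ true
≡ᵇ-refl zero    = refl
≡ᵇ-refl (suc m) = ≡ᵇ-refl m

image : ℕ → (ℕ → ℕ) → ℕ → Bool
image k g y = any< k (λ i → g i ≡ᵇ y)

count-image : ∀ m k g → (∀ i → i < k → g i < m) → (∀ i j → i < j → j < k → g i ≢ g j) →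
              k ≤ count m (image k g)
count-image m zero    g g<m g-inj = z≤n
count-image m (suc k) g g<m g-inj = begin-strict
  k                       ≤⟨ count-image m k g (λ i i<k → g<m i (m<n⇒m<1+n i<k))
                                              (λ i j i<j j<k → g-inj i j i<j (m<n⇒m<1+n j<k)) ⟩
  count m (image k g)     <⟨ count-mono-< m image⊆ (g<m k ≤-refl) gk∉image gk∈image ⟩
  count m (image (suc k) g) ∎
  where
  open ≤-Reasoning
  image⊆ : image k g ⊆⟨ m ⟩ image (suc k) g
  image⊆ y _ y∈image = trans (cong ((g k ≡ᵇ y) ∨_) y∈image) (∨-zeroʳ _)
  gk∈image : image (suc k) g (g k) ≡ true
  gk∈image = cong (_∨ image k g (g k)) (≡ᵇ-refl (g k))
  gk∉image : image k g (g k) ≡ false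
  gk∉image with image k g (g k) in gk∈image
  ... | false = refl
  ... | true with any<-witness k _ gk∈image
  ...   | i , i<k , gi≡gk = ⊥-elim (g-inj i k i<k ≤-refl (≡ᵇ-sound (g i) (g k) gi≡gk))

[m%n+o]%n≡[m+o]%n : ∀ m o n .{{_ : NonZero n}} → (m % n + o) % n ≡ (m + o) % n
[m%n+o]%n≡[m+o]%n m o n = begin
  (m % n + o) % n         ≡⟨ %-distribˡ-+ (m % n) o n ⟩
  (m % n % n + o % n) % n ≡⟨ cong (λ r → (r + o % n) % n) (m%n%n≡m%n m n) ⟩
  (m % n + o % n) % n     ≡⟨ %-distribˡ-+ m o n ⟨
  (m + o) % n             ∎
  where open ≡-Reasoning

[m+o%n]%n≡[m+o]%n : ∀ m o n .{{_ : NonZero n}} → (m + o % n) % n ≡ (m + o) % n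
[m+o%n]%n≡[m+o]%n m o n = begin
  (m + o % n) % n ≡⟨ %-congˡ (+-comm m (o % n)) ⟩
  (o % n + m) % n ≡⟨ [m%n+o]%n≡[m+o]%n o m n ⟩
  (o + m) % n     ≡⟨ %-congˡ (+-comm o m) ⟩
  (m + o) % n     ∎
  where open ≡-Reasoning

[m*[o%n]]%n≡[m*o]%n : ∀ m o n .{{_ : NonZero n}} → (m * (o % n)) % n ≡ (m * o) % n
[m*[o%n]]%n≡[m*o]%n m o n = begin
  (m * (o % n)) % n       ≡⟨ %-distribˡ-* m (o % n) n ⟩
  (m % n * (o % n % n)) % n ≡⟨ cong (λ r → (m % n * r) % n) (m%n%n≡m%n o n) ⟩
  (m % n * (o % n)) % n   ≡⟨ %-distribˡ-* m o n ⟨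
  (m * o) % n             ∎
  where open ≡-Reasoning

[m+a+[n∸a]]%n≡m%n : ∀ m {a} n .{{_ : NonZero n}} → a ≤ n → (m + a + (n ∸ a)) % n ≡ m % n
[m+a+[n∸a]]%n≡m%n m {a} n a≤n = begin
  (m + a + (n ∸ a)) % n ≡⟨ %-congˡ (+-assoc m a (n ∸ a)) ⟩
  (m + (a + (n ∸ a))) % n ≡⟨ %-congˡ (cong (m +_) (m+[n∸m]≡n a≤n)) ⟩
  (m + n) % n           ≡⟨ [m+n]%n≡m%n m n ⟩
  m % n                 ∎
  where open ≡-Reasoning

o%n≡1%n⇒[m*o]%n≡m%n : ∀ m o n .{{_ : NonZero n}} → o % n ≡ 1 % n → (m * o) % n ≡ m % n
o%n≡1%n⇒[m*o]%n≡m%n m o n o≡1 = begin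
  (m * o) % n       ≡⟨ [m*[o%n]]%n≡[m*o]%n m o n ⟨
  (m * (o % n)) % n ≡⟨ cong (λ r → (m * r) % n) o≡1 ⟩
  (m * (1 % n)) % n ≡⟨ [m*[o%n]]%n≡[m*o]%n m 1 n ⟩
  (m * 1) % n       ≡⟨ %-congˡ (*-identityʳ m) ⟩
  m % n             ∎
  where open ≡-Reasoning

suc[m+n∸1]≡m+n : ∀ m n .{{_ : NonZero n}} → suc (m + n ∸ 1) ≡ m + n
suc[m+n∸1]≡m+n m n = begin
  suc (m + n ∸ 1)   ≡⟨ cong suc (+-∸-assoc m (>-nonZero⁻¹ n)) ⟩
  suc (m + (n ∸ 1)) ≡⟨ +-suc m (n ∸ 1) ⟨
  m + suc (pred n)  ≡⟨ cong (m +_) (suc-pred n) ⟩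
  m + n             ∎
  where open ≡-Reasoning

m≤⌈m/n⌉*n : ∀ m n .{{_ : NonZero n}} → m ≤ ⌈ m / n ⌉ * n
m≤⌈m/n⌉*n m n = +-cancelˡ-≤ n m (⌈ m / n ⌉ * n) (begin
  n + m                   ≡⟨ +-comm n m ⟩
  m + n                   ≡⟨ suc[m+n∸1]≡m+n m n ⟨
  suc N                   ≡⟨ cong suc (m≡m%n+[m/n]*n N n) ⟩
  suc (N % n + N / n * n) ≤⟨ +-monoˡ-≤ (N / n * n) (m%n<n N n) ⟩
  n + N / n * n           ∎)
  where
  open ≤-Reasoning
  N = m + n ∸ 1

⌈m/n⌉>0 : ∀ m n .{{_ : NonZero m}} .{{_ : NonZero n}} → 0 < ⌈ m / n ⌉
⌈m/n⌉>0 m n = m≥n⇒m/n>0 (s≤s⁻¹ (begin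
  suc n           ≤⟨ +-monoˡ-≤ n (>-nonZero⁻¹ m) ⟩
  m + n           ≡⟨ suc[m+n∸1]≡m+n m n ⟨
  suc (m + n ∸ 1) ∎))
  where open ≤-Reasoning

-- Subsets of ℤ/e are Boolean predicates on ℕ, of which only the values below e matter.
module Residues (e : ℕ) .{{_ : NonZero e}} where

  infixl 6 _⊕_

  _⊕_ : ℕ → ℕ → ℕ
  a ⊕ b = (a + b) % e

  ∣_∣ : (ℕ → Bool) → ℕ
  ∣ P ∣ = count e P

  Full : (ℕ → Bool) → Set
  Full P = ∀ x → x < e → P x ≡ true

  Nonempty : (ℕ → Bool) → Set
  Nonempty P = ∃[ x ] x < e × P x ≡ true

  IsUnit : ℕ → Set
  IsUnit x = ∃[ c ] (c * x) % e ≡ 1 % e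

  NonzeroUnits : (ℕ → Bool) → Set
  NonzeroUnits B = ∀ {x} → x < e → B x ≡ true → x ≢ 0 → IsUnit x

  SumsetWithin : (A B C : ℕ → Bool) → Set
  SumsetWithin A B C = ∀ {a b} → a < e → b < e → A a ≡ true → B b ≡ true → C (a ⊕ b) ≡ true

  ⊕-identityʳ : ∀ {a} → a < e → a ⊕ 0 ≡ a
  ⊕-identityʳ {a} a<e = trans (%-congˡ (+-identityʳ a)) (m<n⇒m%n≡m a<e)

  [a⊕y]⊕[x⊕[e∸a]]≡x⊕y : ∀ {a} x y → a ≤ e → (a ⊕ y) ⊕ (x ⊕ (e ∸ a)) ≡ x ⊕ y
  [a⊕y]⊕[x⊕[e∸a]]≡x⊕y {a} x y a≤e = begin
    ((a + y) % e + (x + (e ∸ a)) % e) % e ≡⟨ [m%n+o]%n≡[m+o]%n (a + y) _ e ⟩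
    (a + y + (x + (e ∸ a)) % e) % e       ≡⟨ [m+o%n]%n≡[m+o]%n (a + y) _ e ⟩
    (a + y + (x + (e ∸ a))) % e           ≡⟨ %-congˡ (solve 4 (λ a y x d → a :+ y :+ (x :+ d) := x :+ y :+ a :+ d)
                                                              refl a y x (e ∸ a)) ⟩
    (x + y + a + (e ∸ a)) % e             ≡⟨ [m+a+[n∸a]]%n≡m%n (x + y) e a≤e ⟩
    (x + y) % e                           ∎
    where open ≡-Reasoning

  [a⊕y]⊕[e∸a]≡y : ∀ {a y} → a ≤ e → y < e → (a ⊕ y) ⊕ (e ∸ a) ≡ y
  [a⊕y]⊕[e∸a]≡y {a} {y} a≤e y<e = begin
    (a ⊕ y) ⊕ (e ∸ a)       ≡⟨ [m+o%n]%n≡[m+o]%n (a ⊕ y) (e ∸ a) e ⟨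
    (a ⊕ y) ⊕ (0 ⊕ (e ∸ a)) ≡⟨ [a⊕y]⊕[x⊕[e∸a]]≡x⊕y 0 y a≤e ⟩
    y % e                   ≡⟨ m<n⇒m%n≡m y<e ⟩
    y                       ∎
    where open ≡-Reasoning

  count-translate : ∀ P a → ∣ P ∣ ≡ ∣ (λ y → P (a ⊕ y)) ∣
  count-translate P zero    = count-cong e (λ y y<e → cong P (sym (m<n⇒m%n≡m y<e)))
  count-translate P (suc a) = begin
    ∣ P ∣                      ≡⟨ count-translate P a ⟩
    ∣ P′ ∣                     ≡⟨ count-rotate e P′ P′e≡P′0 ⟨
    count e (P′ ∘ suc)         ≡⟨ count-cong e (λ y _ → cong (λ z → P (z % e)) (+-suc a y)) ⟩
    ∣ (λ y → P (suc a ⊕ y)) ∣  ∎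
    where
    open ≡-Reasoning
    P′ : ℕ → Bool
    P′ y = P (a ⊕ y)
    P′e≡P′0 : P′ e ≡ P′ 0
    P′e≡P′0 = cong P (trans ([m+n]%n≡m%n a e) (%-congˡ (sym (+-identityʳ a))))

  ⊆-sumset : ∀ {A B C} → B 0 ≡ true → SumsetWithin A B C → A ⊆⟨ e ⟩ C
  ⊆-sumset {C = C} B0 A+B⊆C a a<e Aa =
    subst (λ x → C x ≡ true) (⊕-identityʳ a<e) (A+B⊆C a<e (>-nonZero⁻¹ e) Aa B0)

  unit-closed⇒full : ∀ {A x} → IsUnit x → Nonempty A →
                     (∀ {a} → a < e → A a ≡ true → A (a ⊕ x) ≡ true) → Full A
  unit-closed⇒full {A} {x} (c , cx≡1) (a₀ , a₀<e , Aa₀) closed y y<e =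
    subst (λ z → A z ≡ true) a₀+w*c*x≡y (iterate (w * c))
    where
    -- Adding x (w * c) times adds w * (c * x) ≡ w; take w ≡ y - a₀.
    iterate : ∀ j → A ((a₀ + j * x) % e) ≡ true
    iterate zero    = subst (λ z → A z ≡ true) (sym (⊕-identityʳ a₀<e)) Aa₀
    iterate (suc j) = subst (λ z → A z ≡ true) step (closed (m%n<n _ e) (iterate j))
      where
      step : (a₀ + j * x) % e ⊕ x ≡ (a₀ + suc j * x) % e
      step = trans ([m%n+o]%n≡[m+o]%n (a₀ + j * x) x e)
                   (%-congˡ (trans (+-assoc a₀ (j * x) x) (cong (a₀ +_) (+-comm (j * x) x))))
    w = y + (e ∸ a₀)
    a₀+w*c*x≡y : (a₀ + w * c * x) % e ≡ y
    a₀+w*c*x≡y = begin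
      (a₀ + w * c * x) % e         ≡⟨ %-congˡ (cong (a₀ +_) (*-assoc w c x)) ⟩
      (a₀ + w * (c * x)) % e       ≡⟨ [m+o%n]%n≡[m+o]%n a₀ _ e ⟨
      (a₀ + (w * (c * x)) % e) % e ≡⟨ cong (λ r → (a₀ + r) % e) (o%n≡1%n⇒[m*o]%n≡m%n w (c * x) e cx≡1) ⟩
      (a₀ + w % e) % e             ≡⟨ [m+o%n]%n≡[m+o]%n a₀ w e ⟩
      (a₀ + (y + (e ∸ a₀))) % e    ≡⟨ %-congˡ (solve 3 (λ a y d → a :+ (y :+ d) := y :+ a :+ d) refl a₀ y (e ∸ a₀)) ⟩
      (y + a₀ + (e ∸ a₀)) % e      ≡⟨ [m+a+[n∸a]]%n≡m%n y e (<⇒≤ a₀<e) ⟩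
      y % e                        ≡⟨ m<n⇒m%n≡m y<e ⟩
      y                            ∎
      where open ≡-Reasoning

  not-true : ∀ b → not b ≡ true → b ≡ false
  not-true false _ = refl

  escapes : (A B : ℕ → Bool) → ℕ → ℕ → Bool
  escapes A B a b = A a ∧ B b ∧ not (A (a ⊕ b))

  closed-or-escape : ∀ A B → SumsetWithin A B A ⊎
                     ∃[ a ] ∃[ b ] a < e × b < e × A a ≡ true × B b ≡ true × A (a ⊕ b) ≡ false
  closed-or-escape A B with search e (λ a → any< e (escapes A B a))
  ... | inj₁ (a , a<e , a-escapes) with any<-witness e (escapes A B a) a-escapes
  ...   | b , b<e , escape = inj₂ (a , b , a<e , b<e , ∧-conicalˡ (A a) _ escape ,
                                   ∧-conicalˡ (B b) _ (∧-conicalʳ (A a) _ escape) ,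
                                   not-true _ (∧-conicalʳ (B b) _ (∧-conicalʳ (A a) _ escape)))
  closed-or-escape A B | inj₂ none = inj₁ closed
    where
    closed : SumsetWithin A B A
    closed {a} {b} a<e b<e Aa Bb with A (a ⊕ b) in Aab
    ... | true  = refl
    ... | false with () <- trans (sym (any<-intro e (escapes A B a) b<e
                                   (cong₂ _∧_ Aa (cong₂ _∧_ Bb (cong not Aab))))) (none a a<e)

  -- x ⊕ (e ∸ a) is x - a, so A′ = A ∪ (a + B) and B′ = B ∩ (A - a).
  module DysonTransform (A B : ℕ → Bool) {a} (a<e : a < e) (Aa : A a ≡ true) where

    A′ : ℕ → Bool
    A′ x = A x ∨ B (x ⊕ (e ∸ a))

    B′ : ℕ → Bool
    B′ y = B y ∧ A (a ⊕ y)

    B′⊆B : B′ ⊆⟨ e ⟩ B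
    B′⊆B y _ = ∧-conicalˡ (B y) _

    A⊆A′ : A ⊆⟨ e ⟩ A′
    A⊆A′ x _ Ax = cong (_∨ _) Ax

    B′0 : B 0 ≡ true → B′ 0 ≡ true
    B′0 B0 = cong₂ _∧_ B0 (trans (cong A (⊕-identityʳ a<e)) Aa)

    ∣A′∣+∣B′∣≡∣A∣+∣B∣ : ∣ A′ ∣ + ∣ B′ ∣ ≡ ∣ A ∣ + ∣ B ∣
    ∣A′∣+∣B′∣≡∣A∣+∣B∣ = begin
      ∣ A′ ∣ + ∣ B′ ∣                    ≡⟨ cong (∣ A′ ∣ +_) ∣A∧a+B∣≡∣B′∣ ⟨
      ∣ A′ ∣ + ∣ (λ x → A x ∧ a+B x) ∣   ≡⟨ count-∨-∧ e A a+B ⟩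
      ∣ A ∣ + ∣ a+B ∣                    ≡⟨ cong (∣ A ∣ +_) ∣a+B∣≡∣B∣ ⟩
      ∣ A ∣ + ∣ B ∣                      ∎
      where
      open ≡-Reasoning
      a+B : ℕ → Bool
      a+B x = B (x ⊕ (e ∸ a))
      ∣a+B∣≡∣B∣ : ∣ a+B ∣ ≡ ∣ B ∣
      ∣a+B∣≡∣B∣ = sym (trans (count-translate B (e ∸ a))
                           (count-cong e (λ y _ → cong (λ z → B (z % e)) (+-comm (e ∸ a) y))))
      ∣A∧a+B∣≡∣B′∣ : ∣ (λ x → A x ∧ a+B x) ∣ ≡ ∣ B′ ∣
      ∣A∧a+B∣≡∣B′∣ = trans (count-translate _ a) (count-cong e (λ y y<e → begin
        A (a ⊕ y) ∧ B ((a ⊕ y) ⊕ (e ∸ a)) ≡⟨ cong (λ z → A (a ⊕ y) ∧ B z) ([a⊕y]⊕[e∸a]≡y (<⇒≤ a<e) y<e) ⟩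
        A (a ⊕ y) ∧ B y                   ≡⟨ ∧-comm (A (a ⊕ y)) (B y) ⟩
        B′ y                              ∎))

    ∣B′∣<∣B∣ : ∀ {b} → b < e → B b ≡ true → A (a ⊕ b) ≡ false → ∣ B′ ∣ < ∣ B ∣
    ∣B′∣<∣B∣ b<e Bb Aab = count-mono-< e B′⊆B b<e (cong₂ _∧_ Bb Aab) Bb

    sumset-transform : ∀ {C} → SumsetWithin A B C → SumsetWithin A′ B′ C
    sumset-transform {C} A+B⊆C {x} {y} x<e y<e A′x B′y with A x in Ax
    ... | true  = A+B⊆C x<e y<e Ax (∧-conicalˡ (B y) _ B′y)
    ... | false = subst (λ z → C z ≡ true) ([a⊕y]⊕[x⊕[e∸a]]≡x⊕y x y (<⇒≤ a<e))
                        (A+B⊆C (m%n<n _ e) (m%n<n _ e) (∧-conicalʳ (B y) _ B′y) A′x)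

  chowla-closed : ∀ {A B C} → B 0 ≡ true → NonzeroUnits B → Nonempty A →
                  SumsetWithin A B A → SumsetWithin A B C → Full C ⊎ ∣ A ∣ + ∣ B ∣ ≤ suc ∣ C ∣
  chowla-closed {A} {B} {C} B0 units nonempty A+B⊆A A+B⊆C
    with search e (λ x → B x ∧ not (x ≡ᵇ 0))
  ... | inj₁ (x , x<e , Bx∧x≢0) = inj₁ (λ y y<e → ⊆-sumset B0 A+B⊆C y y<e (A-full y y<e))
    where
    Bx : B x ≡ true
    Bx = ∧-conicalˡ _ _ Bx∧x≢0
    x≢0 : x ≢ 0
    x≢0 x≡0 with () <- trans (sym (cong (λ z → not (z ≡ᵇ 0)) x≡0)) (∧-conicalʳ _ _ Bx∧x≢0)
    A-full : Full A
    A-full = unit-closed⇒full (units x<e Bx x≢0) nonempty (λ a<e Aa → A+B⊆A a<e x<e Aa Bx)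
  ... | inj₂ B⊆0 = inj₂ (begin
    ∣ A ∣ + ∣ B ∣ ≤⟨ +-mono-≤ (count-mono e (⊆-sumset B0 A+B⊆C)) (count-≤1 e only0) ⟩
    ∣ C ∣ + 1     ≡⟨ +-comm ∣ C ∣ 1 ⟩
    suc ∣ C ∣     ∎)
    where
    open ≤-Reasoning
    only0 : ∀ x → x < e → B x ≡ true → x ≡ 0
    only0 x x<e Bx with x ≡ᵇ 0 in x≟0 | B⊆0 x x<e
    ... | true  | _        = ≡ᵇ-sound x 0 x≟0
    ... | false | Bx∧true≡false with () <- trans (cong (_∧ true) (sym Bx)) Bx∧true≡false

  -- Induction on ∣ B ∣: if A + B ⊄ A, the Dyson transform at an escaping a ∈ A keeps
  -- ∣ A ∣ + ∣ B ∣, strictly shrinks B and keeps the sumset inside C.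
  chowla : ∀ N {A B C} → ∣ B ∣ ≤ N → B 0 ≡ true → NonzeroUnits B → Nonempty A →
           SumsetWithin A B C → Full C ⊎ ∣ A ∣ + ∣ B ∣ ≤ suc ∣ C ∣
  chowla N {A} {B} {C} ∣B∣≤N B0 units nonempty A+B⊆C with closed-or-escape A B | N
  ... | inj₁ A+B⊆A | _ = chowla-closed B0 units nonempty A+B⊆A A+B⊆C
  ... | inj₂ (a , b , a<e , b<e , Aa , Bb , Aab) | zero =
    ⊥-elim (n≮0 (<-≤-trans (∣B′∣<∣B∣ b<e Bb Aab) ∣B∣≤N))
    where open DysonTransform A B a<e Aa
  ... | inj₂ (a , b , a<e , b<e , Aa , Bb , Aab) | suc N =
    map₂ (subst (_≤ suc ∣ C ∣) ∣A′∣+∣B′∣≡∣A∣+∣B∣)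
         (chowla N (s≤s⁻¹ (<-≤-trans (∣B′∣<∣B∣ b<e Bb Aab) ∣B∣≤N)) (B′0 B0)
                   (λ x<e B′x → units x<e (B′⊆B _ x<e B′x))
                   (let (a₀ , a₀<e , Aa₀) = nonempty in a₀ , a₀<e , A⊆A′ a₀ a₀<e Aa₀)
                   (sumset-transform {C} A+B⊆C))
    where open DysonTransform A B a<e Aa

  infixl 6 _⊕ˢ_

  _⊕ˢ_ : (ℕ → Bool) → (ℕ → Bool) → ℕ → Bool
  (A ⊕ˢ B) x = any< e (λ a → A a ∧ any< e (λ b → B b ∧ (a ⊕ b ≡ᵇ x)))

  ⊕ˢ-sumset : ∀ A B → SumsetWithin A B (A ⊕ˢ B)
  ⊕ˢ-sumset A B {a} {b} a<e b<e Aa Bb =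
    any<-intro e (λ a′ → A a′ ∧ any< e (λ b′ → B b′ ∧ (a′ ⊕ b′ ≡ᵇ a ⊕ b))) a<e (cong₂ _∧_ Aa
      (any<-intro e (λ b′ → B b′ ∧ (a ⊕ b′ ≡ᵇ a ⊕ b)) b<e (cong₂ _∧_ Bb (≡ᵇ-refl (a ⊕ b)))))

  ⊕ˢ-elim : ∀ A B {x} → (A ⊕ˢ B) x ≡ true →
            ∃[ a ] ∃[ b ] a < e × b < e × A a ≡ true × B b ≡ true × a ⊕ b ≡ x
  ⊕ˢ-elim A B {x} x∈A+B with any<-witness e _ x∈A+B
  ... | a , a<e , Aa∧b with any<-witness e (λ b → B b ∧ (a ⊕ b ≡ᵇ x)) (∧-conicalʳ (A a) _ Aa∧b)
  ...   | b , b<e , Bb∧a+b≡x =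
    a , b , a<e , b<e , ∧-conicalˡ (A a) _ Aa∧b , ∧-conicalˡ (B b) _ Bb∧a+b≡x ,
    ≡ᵇ-sound (a ⊕ b) x (∧-conicalʳ (B b) _ Bb∧a+b≡x)

module PowersOf (q e n : ℕ) .{{_ : NonZero e}} (order : IsOrder q e n) where

  open Residues e

  instance
    n≢0 : NonZero n
    n≢0 = >-nonZero (proj₁ order)

  power : ℕ → ℕ
  power i = q ^ i % e

  powers : ℕ → Bool
  powers = image n power

  powers₀ : ℕ → Bool
  powers₀ x = (x ≡ᵇ 0) ∨ powers x

  q^[n∸i]*power-i≡1 : ∀ {i} → i ≤ n → (q ^ (n ∸ i) * power i) % e ≡ 1 % e
  q^[n∸i]*power-i≡1 {i} i≤n = begin
    (q ^ (n ∸ i) * power i) % e ≡⟨ [m*[o%n]]%n≡[m*o]%n (q ^ (n ∸ i)) (q ^ i) e ⟩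
    (q ^ (n ∸ i) * q ^ i) % e   ≡⟨ %-congˡ (^-distribˡ-+-* q (n ∸ i) i) ⟨
    q ^ (n ∸ i + i) % e         ≡⟨ cong (λ s → q ^ s % e) (m∸n+n≡m i≤n) ⟩
    q ^ n % e                   ≡⟨ proj₁ (proj₂ order) ⟩
    1 % e                       ∎
    where open ≡-Reasoning

  power-isUnit : ∀ {i} → i < n → IsUnit (power i)
  power-isUnit {i} i<n = q ^ (n ∸ i) , q^[n∸i]*power-i≡1 (<⇒≤ i<n)

  power-injective : ∀ i j → i < j → j < n → power i ≢ power j
  power-injective i j i<j j<n pi≡pj = proj₂ (proj₂ order) (n ∸ j + i) 0<s s<n (begin
    q ^ (n ∸ j + i) % e         ≡⟨ %-congˡ (^-distribˡ-+-* q (n ∸ j) i) ⟩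
    (q ^ (n ∸ j) * q ^ i) % e   ≡⟨ [m*[o%n]]%n≡[m*o]%n (q ^ (n ∸ j)) (q ^ i) e ⟨
    (q ^ (n ∸ j) * power i) % e ≡⟨ cong (λ r → (q ^ (n ∸ j) * r) % e) pi≡pj ⟩
    (q ^ (n ∸ j) * power j) % e ≡⟨ q^[n∸i]*power-i≡1 (<⇒≤ j<n) ⟩
    1 % e                       ∎)
    where
    open ≡-Reasoning
    0<s : 0 < n ∸ j + i
    0<s = ≤-trans (m<n⇒0<n∸m j<n) (m≤m+n (n ∸ j) i)
    s<n : n ∸ j + i < n
    s<n = subst (n ∸ j + i <_) (m∸n+n≡m (<⇒≤ j<n)) (+-monoʳ-< (n ∸ j) i<j)

  power≢0 : 1 < e → ∀ {i} → i < n → power i ≢ 0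
  power≢0 1<e {i} i<n pi≡0 = 1+n≢0 (begin
    1                           ≡⟨ m<n⇒m%n≡m 1<e ⟨
    1 % e                       ≡⟨ q^[n∸i]*power-i≡1 (<⇒≤ i<n) ⟨
    (q ^ (n ∸ i) * power i) % e ≡⟨ cong (λ r → (q ^ (n ∸ i) * r) % e) pi≡0 ⟩
    (q ^ (n ∸ i) * 0) % e       ≡⟨ %-congˡ (*-zeroʳ (q ^ (n ∸ i))) ⟩
    0 % e                       ≡⟨ m<n⇒m%n≡m (>-nonZero⁻¹ e) ⟩
    0                           ∎)
    where open ≡-Reasoning

  powers-elim : ∀ {x} → powers x ≡ true → ∃[ i ] i < n × power i ≡ x
  powers-elim {x} x∈powers with any<-witness n _ x∈powers
  ... | i , i<n , pi≡ᵇx = i , i<n , ≡ᵇ-sound (power i) x pi≡ᵇx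

  powers₀-elim : ∀ {x} → powers₀ x ≡ true → x ≡ 0 ⊎ ∃[ i ] i < n × power i ≡ x
  powers₀-elim {x} x∈powers₀ with x ≡ᵇ 0 in x≟0
  ... | true  = inj₁ (≡ᵇ-sound x 0 x≟0)
  ... | false = inj₂ (powers-elim x∈powers₀)

  powers₀-units : NonzeroUnits powers₀
  powers₀-units _ x∈powers₀ x≢0 with powers₀-elim x∈powers₀
  ... | inj₁ x≡0              = ⊥-elim (x≢0 x≡0)
  ... | inj₂ (i , i<n , refl) = power-isUnit i<n

  ∣powers∣≥n : n ≤ ∣ powers ∣
  ∣powers∣≥n = count-image e n power (λ i _ → m%n<n (q ^ i) e) power-injective

  ∣powers₀∣>n : 1 < e → n < ∣ powers₀ ∣
  ∣powers₀∣>n 1<e = <-≤-trans (s≤s ∣powers∣≥n) (count-mono-< e powers⊆powers₀ (>-nonZero⁻¹ e) 0∉powers refl)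
    where
    powers⊆powers₀ : powers ⊆⟨ e ⟩ powers₀
    powers⊆powers₀ x _ x∈powers = trans (cong ((x ≡ᵇ 0) ∨_) x∈powers) (∨-zeroʳ _)
    0∉powers : powers 0 ≡ false
    0∉powers with powers 0 in 0∈powers
    ... | false = refl
    ... | true with powers-elim 0∈powers
    ...   | i , i<n , pi≡0 = ⊥-elim (power≢0 1<e i<n pi≡0)

  sums : ℕ → ℕ → Bool
  sums zero    = powers
  sums (suc j) = sums j ⊕ˢ powers₀

  sums⊆sums : ∀ j → sums j ⊆⟨ e ⟩ sums (suc j)
  sums⊆sums j = ⊆-sumset refl (⊕ˢ-sumset (sums j) powers₀)

  power0∈sums : ∀ j → sums j (power 0) ≡ true
  power0∈sums zero    = any<-intro n (λ i → power i ≡ᵇ power 0) (>-nonZero⁻¹ n) (≡ᵇ-refl (power 0))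
  power0∈sums (suc j) = sums⊆sums j (power 0) (m%n<n 1 e) (power0∈sums j)

  sums-growth : 1 < e → ∀ j → Full (sums j) ⊎ suc j * n ≤ ∣ sums j ∣
  sums-growth 1<e zero    = inj₂ (subst (_≤ ∣ powers ∣) (sym (+-identityʳ n)) ∣powers∣≥n)
  sums-growth 1<e (suc j) with sums-growth 1<e j
  ... | inj₁ full  = inj₁ (λ x x<e → sums⊆sums j x x<e (full x x<e))
  ... | inj₂ bound = map₂ grow (chowla ∣ powers₀ ∣ ≤-refl refl powers₀-units
                                      (power 0 , m%n<n 1 e , power0∈sums j) (⊕ˢ-sumset (sums j) powers₀))
    where
    grow : ∣ sums j ∣ + ∣ powers₀ ∣ ≤ suc ∣ sums (suc j) ∣ → suc (suc j) * n ≤ ∣ sums (suc j) ∣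
    grow le = subst (_≤ ∣ sums (suc j) ∣) (+-comm (suc j * n) n) (s≤s⁻¹ (begin
      suc (suc j * n + n)         ≡⟨ +-suc (suc j * n) n ⟨
      suc j * n + suc n           ≤⟨ +-mono-≤ bound (∣powers₀∣>n 1<e) ⟩
      ∣ sums j ∣ + ∣ powers₀ ∣    ≤⟨ le ⟩
      suc ∣ sums (suc j) ∣        ∎))
      where open ≤-Reasoning

  SumOfAtMost : ℕ → ℕ → Set
  SumOfAtMost k x = ∃[ as ] 0 < length as × length as ≤ k × sum (map (q ^_) as) % e ≡ x

  sums-sound : ∀ j {x} → sums j x ≡ true → SumOfAtMost (suc j) x
  sums-sound zero x∈powers with powers-elim x∈powers
  ... | i , _ , refl = i ∷ [] , z<s , ≤-refl , %-congˡ (+-identityʳ (q ^ i))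
  sums-sound (suc j) x∈sums with ⊕ˢ-elim (sums j) powers₀ x∈sums
  ... | y , b , y<e , _ , y∈sums , b∈powers₀ , refl with sums-sound j y∈sums | powers₀-elim b∈powers₀
  ...   | as , 0<len , len≤ , Σ≡y | inj₁ refl =
    as , 0<len , m≤n⇒m≤1+n len≤ , trans Σ≡y (sym (⊕-identityʳ y<e))
  ...   | as , 0<len , len≤ , Σ≡y | inj₂ (i , _ , refl) = i ∷ as , z<s , s≤s len≤ , (begin
    (q ^ i + S) % e           ≡⟨ %-congˡ (+-comm (q ^ i) S) ⟩
    (S + q ^ i) % e           ≡⟨ %-distribˡ-+ S (q ^ i) e ⟩
    (S % e + power i) % e     ≡⟨ cong (λ r → (r + power i) % e) Σ≡y ⟩
    y ⊕ power i               ∎)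
    where
    open ≡-Reasoning
    S = sum (map (q ^_) as)

  suc-pred⌈e/n⌉ : suc (pred ⌈ e / n ⌉) ≡ ⌈ e / n ⌉
  suc-pred⌈e/n⌉ = suc-pred ⌈ e / n ⌉ {{>-nonZero (⌈m/n⌉>0 e n)}}

  0∈sums : 1 < e → sums (pred ⌈ e / n ⌉) 0 ≡ true
  0∈sums 1<e with sums-growth 1<e (pred ⌈ e / n ⌉)
  ... | inj₁ full  = full 0 (>-nonZero⁻¹ e)
  ... | inj₂ bound = count≥k⇒all e (begin
    e                                 ≤⟨ m≤⌈m/n⌉*n e n ⟩
    ⌈ e / n ⌉ * n                     ≡⟨ cong (_* n) suc-pred⌈e/n⌉ ⟨
    suc (pred ⌈ e / n ⌉) * n          ≤⟨ bound ⟩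
    ∣ sums (pred ⌈ e / n ⌉) ∣         ∎) 0 (>-nonZero⁻¹ e)
    where open ≤-Reasoning

  short-vanishing-sum : 1 < e →
    ∃[ as ] 0 < length as × length as ≤ ⌈ e / n ⌉ × e ∣ sum (map (q ^_) as)
  short-vanishing-sum 1<e with sums-sound (pred ⌈ e / n ⌉) (0∈sums 1<e)
  ... | as , 0<len , len≤ , Σ≡0 =
    as , 0<len , subst (length as ≤_) suc-pred⌈e/n⌉ len≤ , m%n≡0⇒n∣m _ e Σ≡0

IsM⇒≤length : ∀ {q e t} → IsM q e t →
              ∀ as → 0 < length as → e ∣ sum (map (q ^_) as) → t ≤ length as
IsM⇒≤length (_ , _ , minimal) as 0<len e∣Σ =
  ≮⇒≥ (λ len<t → minimal (length as) 0<len len<t (as , refl , e∣Σ))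

-- Coprimality is implied by the existence of the order, so it (like 0 < q) is unused.
theorem1 : (q e n t : ℕ) → (0<q : 0 < q) → (0<e : 0 < e) → Coprime q e
         → (ord : IsOrder q e n {{>-nonZero 0<e}})
         → IsM q e t
         → t ≤ ⌈ e / n ⌉ {{>-nonZero (proj₁ ord)}}
theorem1 q 1 n t _ _ _ ord isM =
  ≤-trans (IsM⇒≤length isM (0 ∷ []) z<s (1∣ _)) (⌈m/n⌉>0 1 n {{_}} {{>-nonZero (proj₁ ord)}})
theorem1 q e@(suc (suc _)) n t _ _ _ ord isM with PowersOf.short-vanishing-sum q e n ord (s≤s z<s)
... | as , 0<len , len≤ , e∣Σ = ≤-trans (IsM⇒≤length isM as 0<len e∣Σ) len≤
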